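{- Let $P$ be a Horn mca-program. Then: (1) $P$ has at least one derivable model; (2) $P$ has a largest derivable model; (3) every derivable model of $P$ is a supported model of $P$; (4) for every model $M$ of $P$ there is a derivable model $M'$ of $P$ such that $M' \subseteq M$; (5) every minimal model of $P$ is derivable.
   Context: Let $\mathit{At}$ be a set of propositional atoms. An mc-atom over $\mathit{At}$ is an expression $kX$, where $k$ is a non-negative integer and $X \subseteq \mathit{At}$ is finite with $k \leq |X|$; $\mathit{aset}(kX) = X$. An mc-literal is $A$ or $\mathbf{not}(A)$ for an mc-atom $A$. An mca-clause $r$ is an expression $H \leftarrow L_1, \ldots, L_m$ ($m \geq 0$), where $H$ is an mc-atom and the $L_i$ are mc-literals, with $\mathit{hd}(r) = H$, $\mathit{bd}(r) = \{L_1, \ldots, L_m\}$, and $\mathit{hset}(r) = \mathit{aset}(H)$. An mca-program is a set of mca-clauses. It is Horn if no clause body contains a literal of the form $\mathbf{not}(A)$. For a set $Q$ of clauses, $\mathit{hset}(Q) = \bigcup\{\mathit{hset}(r) : r \in Q\}$. Satisfaction, for $M \subseteq \mathit{At}$: - $M \models kX$ iff $|M \cap X| \geq k$. - $M \models \mathbf{not}(kX)$ iff $|M \cap X| < k$. - $M \models \mathit{bd}(r)$ iff $M$ satisfies all literals of $\mathit{bd}(r)$. - $M$ satisfies $r$ if $M \models \mathit{hd}(r)$ whenever $M \models \mathit{bd}(r)$. - $M$ is a model of $P$ if it satisfies all clauses of $P$. - A minimal model is a model that contains no other model properly. Operators, supported models, computations and derivable models: - $P(M) = \{r \in P : M \models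 \mathit{bd}(r)\}$. - $T^{\mathit{nd}}_P(M)$ is the set of all $M'$ with $M' \subseteq \mathit{hset}(P(M))$ and $M' \models \mathit{hd}(r)$ for all $r \in P(M)$. - $M$ is a supported model of $P$ if $M \in T^{\mathit{nd}}_P(M)$. - A $P$-computation is a sequence $(X_n)_{n \geq 0}$ with $X_0 = \emptyset$ and, for all $n$, $X_n \subseteq X_{n+1}$ and $X_{n+1} \in T^{\mathit{nd}}_P(X_n)$. - Its result is $\bigcup_n X_n$. - A derivable model of $P$ is the result of some $P$-computation. -}

module Defs where

open import Data.Nat using (ℕ; zero; suc; _≤_; _≥_; _<_)
open import Data.List using (List; length)
open import Data.List.Membership.Propositional using (_∈_)
open import Data.List.Relation.Unary.All using (All)
open import Data.List.Relation.Unary.Unique.Propositional using (Unique)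
open import Data.Product using (Σ; ∃; _×_; _,_)
open import Data.Empty using (⊥)
open import Data.Unit using (⊤)
open import Relation.Nullary using (¬_)
open import Function.Bundles using (_⇔_)
open import Level using (0ℓ) renaming (suc to lsuc)

Subset : Set → Set₁
Subset At = At → Set

_⊆_ : {At : Set} → Subset At → Subset At → Set
M ⊆ N = ∀ a → M a → N a

_≐_ : {At : Set} → Subset At → Subset At → Set
M ≐ N = ∀ a → M a ⇔ N a

∅ : {At : Set} → Subset At
∅ _ = ⊥

module _ {At : Set} where

  record FinSet : Set where
    constructor finset
    field
      elems  : List At
      unique : Unique elems

  card : FinSet → ℕ
  card X = length (FinSet.elems X)

  mem : At → FinSet → Set
  mem a X = a ∈ FinSet.elems X

  record MCAtom : Set where
    constructor mc
    field
      k    : ℕ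
      X    : FinSet
      k≤∣X∣ : k ≤ card X

  aset : MCAtom → Subset At
  aset A a = mem a (MCAtom.X A)

  data MCLit : Set where
    pos : MCAtom → MCLit
    neg : MCAtom → MCLit

  record Clause : Set where
    constructor _←_
    field
      hd : MCAtom
      bd : List MCLit

  open Clause public

  Program : Set₁
  Program = Clause → Set

  IsPos : MCLit → Set
  IsPos (pos _) = ⊤
  IsPos (neg _) = ⊥

  Horn : Program → Set
  Horn P = ∀ r → P r → All IsPos (bd r)

  -- |M ∩ X| ≥ k : there are at least k distinct elements of X lying in M.
  AtLeast : ℕ → Subset At → FinSet → Set
  AtLeast k M X = Σ (List At) λ Y → Unique Y × k ≤ length Y × All (λ y → mem y X × M y) Y

  _⊨A_ : Subset At → MCAtom → Set
  M ⊨A A = AtLeast (MCAtom.k A) M (MCAtom.X A)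

  _⊨L_ : Subset At → MCLit → Set
  M ⊨L pos A = M ⊨A A
  M ⊨L neg A = ¬ (M ⊨A A)

  _⊨bd_ : Subset At → Clause → Set
  M ⊨bd r = All (M ⊨L_) (bd r)

  Satisfies : Subset At → Clause → Set
  Satisfies M r = M ⊨bd r → M ⊨A hd r

  IsModel : Program → Subset At → Set
  IsModel P M = ∀ r → P r → Satisfies M r

  IsMinimalModel : Program → Subset At → Set₁
  IsMinimalModel P M = IsModel P M × (∀ N → IsModel P N → N ⊆ M → M ⊆ N)

  Active : Program → Subset At → Program
  Active P M r = P r × M ⊨bd r

  hset : Program → Subset At
  hset Q a = Σ Clause λ r → Q r × aset (hd r) a

  InTnd : Program → Subset At → Subset At → Set
  InTnd P M M' = (M' ⊆ hset (Active P M)) × (∀ r → Active P M r → M' ⊨A hd r)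

  IsSupportedModel : Program → Subset At → Set
  IsSupportedModel P M = InTnd P M M

  record Computation (P : Program) : Set₁ where
    field
      X      : ℕ → Subset At
      start  : X zero ≐ ∅
      incr   : ∀ n → X n ⊆ X (suc n)
      step   : ∀ n → InTnd P (X n) (X (suc n))

  result : {P : Program} → Computation P → Subset At
  result c a = ∃ λ n → Computation.X c n a

  IsDerivableModel : Program → Subset At → Set₁
  IsDerivableModel P M = Σ (Computation P) λ c → M ≐ result c

{-# OPTIONS --safe #-}
-- For a Horn program, satisfaction of bodies is monotone and, because mc-atoms and bodies are
-- finite, compact: a body true in the union of an increasing chain is true at some stage. Hence
-- every result of a computation is a model, and indeed a supported one. Conversely, below any
-- model M the "capped" sequence X₀ = ∅, Xₙ₊₁ = hset(P(Xₙ)) ∩ M is a computation (M satisfies every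
-- active head, with witnesses inside its aset), and it dominates every computation whose result
-- lies in M. Capping with the full set gives the largest
-- derivable model; capping with a minimal model M gives a model inside M, hence M itself.
module Submission where

open import Defs
open import Data.Product using (Σ; ∃; _×_; _,_; proj₁; proj₂)
open import Data.Nat using (ℕ; zero; suc; _≤_; _⊔_; _≤′_; ≤′-refl; ≤′-step)
open import Data.Nat.Properties using (m≤m⊔n; m≤n⊔m; ≤⇒≤′)
open import Data.List using ([]; _∷_)
open import Data.List.Relation.Unary.All as All using (All; []; _∷_)
open import Data.Unit using (tt)
open import Data.Empty using (⊥-elim)
open import Function using (id; _∘_)
open import Function.Bundles using (mk⇔; Equivalence)
open import Relation.Unary using (U; _∩_; ⋃)

≐⇒⊆ : {At : Set} {M N : Subset At} → M ≐ N → M ⊆ N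
≐⇒⊆ M≐N a = Equivalence.to (M≐N a)

≐⇒⊇ : {At : Set} {M N : Subset At} → M ≐ N → N ⊆ M
≐⇒⊇ M≐N a = Equivalence.from (M≐N a)

⊆-antisym : {At : Set} {M N : Subset At} → M ⊆ N → N ⊆ M → M ≐ N
⊆-antisym M⊆N N⊆M a = mk⇔ (M⊆N a) (N⊆M a)

≐-sym : {At : Set} {M N : Subset At} → M ≐ N → N ≐ M
≐-sym M≐N = ⊆-antisym (≐⇒⊇ M≐N) (≐⇒⊆ M≐N)

All-eventually : {B : Set} (Q : ℕ → B → Set) → (∀ {m n} → m ≤ n → ∀ x → Q m x → Q n x) →
                 ∀ {xs} → All (λ x → ∃ λ n → Q n x) xs → ∃ λ n → All (Q n) xs
All-eventually Q mono [] = 0 , []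
All-eventually Q mono ((m , qx) ∷ qxs) with All-eventually Q mono qxs
... | n , qn = m ⊔ n , mono (m≤m⊔n m n) _ qx ∷ All.map (mono (m≤n⊔m m n) _) qn

module _ {At : Set} where

  ⊨A-mono : {M N : Subset At} → M ⊆ N → ∀ A → M ⊨A A → N ⊨A A
  ⊨A-mono M⊆N A (Y , unique , k≤∣Y∣ , Y⊆X∩M) =
    Y , unique , k≤∣Y∣ , All.map (λ (y∈X , y∈M) → y∈X , M⊆N _ y∈M) Y⊆X∩M

  ⊨L-mono : {M N : Subset At} → M ⊆ N → ∀ l → IsPos l → M ⊨L l → N ⊨L l
  ⊨L-mono M⊆N (pos A) _ = ⊨A-mono M⊆N A

  ⊨bd-mono : {M N : Subset At} → M ⊆ N → ∀ r → All IsPos (bd r) → M ⊨bd r → N ⊨bd r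
  ⊨bd-mono M⊆N r pos-bd M⊨bd =
    All.zipWith (λ (pos-l , M⊨l) → ⊨L-mono M⊆N _ pos-l M⊨l) (pos-bd , M⊨bd)

  U-⊨A : ∀ A → U {A = At} ⊨A A
  U-⊨A (mc k (finset X unique) k≤∣X∣) = X , unique , k≤∣X∣ , All.tabulate (λ x∈X → x∈X , tt)

  U-isModel : (P : Program {At}) → IsModel P (U {A = At})
  U-isModel P r _ _ = U-⊨A (hd r)

  hset-mono : {Q Q′ : Program {At}} → Q ⊆ Q′ → hset Q ⊆ hset Q′
  hset-mono Q⊆Q′ a (r , Qr , a∈hd) = r , Q⊆Q′ r Qr , a∈hd

  Active-mono : {P : Program {At}} → Horn P → {M N : Subset At} → M ⊆ N → Active P M ⊆ Active P N
  Active-mono horn M⊆N r (Pr , M⊨bd) = Pr , ⊨bd-mono M⊆N r (horn r Pr) M⊨bd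

  X₀-⊆ : {P : Program {At}} (c : Computation P) {M : Subset At} → Computation.X c zero ⊆ M
  X₀-⊆ c a a∈X₀ = ⊥-elim (Equivalence.to (Computation.start c a) a∈X₀)

  module Chain {X : ℕ → Subset At} (incr : ∀ n → X n ⊆ X (suc n)) where

    chain-mono′ : ∀ {m n} → m ≤′ n → X m ⊆ X n
    chain-mono′ ≤′-refl        = λ _ → id
    chain-mono′ (≤′-step m≤′n) = λ a → incr _ a ∘ chain-mono′ m≤′n a

    chain-mono : ∀ {m n} → m ≤ n → X m ⊆ X n
    chain-mono = chain-mono′ ∘ ≤⇒≤′

    ⊨A-compact : ∀ A → ⋃ ℕ X ⊨A A → ∃ λ n → X n ⊨A A
    ⊨A-compact A (Y , unique , k≤∣Y∣ , Y⊆X∩⋃) =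
      let n , Y⊆X∩Xn = All-eventually (λ n y → aset A y × X n y)
                                      (λ m≤n y (y∈A , y∈Xm) → y∈A , chain-mono m≤n y y∈Xm)
                                      (All.map (λ (y∈A , (n , y∈Xn)) → n , y∈A , y∈Xn) Y⊆X∩⋃)
      in n , Y , unique , k≤∣Y∣ , Y⊆X∩Xn

    ⊨bd-compact : ∀ r → All IsPos (bd r) → ⋃ ℕ X ⊨bd r → ∃ λ n → X n ⊨bd r
    ⊨bd-compact r pos-bd ⋃⊨bd =
      let n , Xn⊨bd = All-eventually (λ n l → IsPos l × X n ⊨L l)
                                     (λ m≤n l (pos-l , Xm⊨l) → pos-l , ⊨L-mono (chain-mono m≤n) l pos-l Xm⊨l)
                                     (eventually pos-bd ⋃⊨bd)
      in n , All.map proj₂ Xn⊨bd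
      where
        eventually : ∀ {ls} → All IsPos ls → All (⋃ ℕ X ⊨L_) ls → All (λ l → ∃ λ n → IsPos l × X n ⊨L l) ls
        eventually {[]}        []          []            = []
        eventually {pos A ∷ _} (pos-l ∷ ps) (⋃⊨A ∷ ⋃⊨ls) =
          let n , Xn⊨A = ⊨A-compact A ⋃⊨A in (n , pos-l , Xn⊨A) ∷ eventually ps ⋃⊨ls

module _ {At : Set} {P : Program {At}} (horn : Horn P) where

  result-derivable : (c : Computation P) → IsDerivableModel P (result c)
  result-derivable c = c , λ _ → mk⇔ id id

  result-isModel : (c : Computation P) → IsModel P (result c)
  result-isModel c r Pr ⋃⊨bd =
    let n , Xn⊨bd = ⊨bd-compact r (horn r Pr) ⋃⊨bd
    in ⊨A-mono (λ a a∈Xn+1 → suc n , a∈Xn+1) (hd r) (proj₂ (step n) r (Pr , Xn⊨bd))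
    where
      open Computation c
      open Chain incr

  result-⊆-hset : (c : Computation P) → result c ⊆ hset (Active P (result c))
  result-⊆-hset c a (zero , a∈X₀)    = X₀-⊆ c {hset (Active P (result c))} a a∈X₀
  result-⊆-hset c a (suc n , a∈Xn+1) =
    hset-mono (Active-mono horn (λ b b∈Xn → n , b∈Xn)) a (proj₁ (step n) a a∈Xn+1)
    where open Computation c

  result-supported : (c : Computation P) → IsSupportedModel P (result c)
  result-supported c = result-⊆-hset c , λ r (Pr , R⊨bd) → result-isModel c r Pr R⊨bd

  IsSupportedModel-resp-≐ : {M N : Subset At} → M ≐ N → IsSupportedModel P M → IsSupportedModel P N
  IsSupportedModel-resp-≐ M≐N (M⊆hset , M⊨hd) =
      (λ a → hset-mono (Active-mono horn (≐⇒⊆ M≐N)) a ∘ M⊆hset a ∘ ≐⇒⊇ M≐N a)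
    , λ r N-active → ⊨A-mono (≐⇒⊆ M≐N) (hd r) (M⊨hd r (Active-mono horn (≐⇒⊇ M≐N) r N-active))

  derivable⇒supported : {M : Subset At} → IsDerivableModel P M → IsSupportedModel P M
  derivable⇒supported (c , M≐R) = IsSupportedModel-resp-≐ (≐-sym M≐R) (result-supported c)

  capped-chain : Subset At → ℕ → Subset At
  capped-chain M zero    = ∅
  capped-chain M (suc n) = hset (Active P (capped-chain M n)) ∩ M

  capped-chain-⊆ : ∀ M n → capped-chain M n ⊆ M
  capped-chain-⊆ M (suc n) a (_ , a∈M) = a∈M

  capped-chain-incr : ∀ M n → capped-chain M n ⊆ capped-chain M (suc n)
  capped-chain-incr M (suc n) a (a∈hset , a∈M) =
    hset-mono (Active-mono horn (capped-chain-incr M n)) a a∈hset , a∈M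

  capped-chain-step : ∀ {M} → IsModel P M → ∀ n → InTnd P (capped-chain M n) (capped-chain M (suc n))
  capped-chain-step {M} M⊨P n = (λ _ → proj₁) , λ r r-active@(Pr , Xn⊨bd) →
    let Y , unique , k≤∣Y∣ , Y⊆hd∩M = M⊨P r Pr (⊨bd-mono (capped-chain-⊆ M n) r (horn r Pr) Xn⊨bd)
    in Y , unique , k≤∣Y∣ , All.map (λ (y∈hd , y∈M) → y∈hd , (r , r-active , y∈hd) , y∈M) Y⊆hd∩M

  capped : (M : Subset At) → IsModel P M → Computation P
  capped M M⊨P = record
    { X     = capped-chain M
    ; start = λ _ → mk⇔ id id
    ; incr  = capped-chain-incr M
    ; step  = capped-chain-step M⊨P
    }

  capped-⊆ : ∀ {M} (M⊨P : IsModel P M) → result (capped M M⊨P) ⊆ M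
  capped-⊆ {M} _ a (n , a∈Xn) = capped-chain-⊆ M n a a∈Xn

  computation-⊆-capped-chain : ∀ {M} (c : Computation P) → result c ⊆ M →
                               ∀ n → Computation.X c n ⊆ capped-chain M n
  computation-⊆-capped-chain c R⊆M zero = X₀-⊆ c
  computation-⊆-capped-chain c R⊆M (suc n) a a∈Xn+1 =
      hset-mono (Active-mono horn (computation-⊆-capped-chain c R⊆M n)) a (proj₁ (step n) a a∈Xn+1)
    , R⊆M a (suc n , a∈Xn+1)
    where open Computation c

  derivable-⊆-capped : ∀ {M N} (M⊨P : IsModel P M) → IsDerivableModel P N → N ⊆ M →
                       N ⊆ result (capped M M⊨P)
  derivable-⊆-capped M⊨P (c , N≐R) N⊆M a a∈N =
    let n , a∈Xn = ≐⇒⊆ N≐R a a∈N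
    in n , computation-⊆-capped-chain c (λ b → N⊆M b ∘ ≐⇒⊇ N≐R b) n a a∈Xn

  minimal⇒derivable : ∀ {M} → IsMinimalModel P M → IsDerivableModel P M
  minimal⇒derivable {M} (M⊨P , minimal) =
    c , ⊆-antisym (minimal (result c) (result-isModel c) (capped-⊆ M⊨P)) (capped-⊆ M⊨P)
    where
      c : Computation P
      c = capped M M⊨P

corollary4 : {At : Set} (P : Program {At}) → Horn P →
    (Σ (Subset At) λ M → IsDerivableModel P M)
    × (Σ (Subset At) λ M → IsDerivableModel P M × (∀ M' → IsDerivableModel P M' → M' ⊆ M))
    × (∀ M → IsDerivableModel P M → IsSupportedModel P M)
    × (∀ M → IsModel P M → Σ (Subset At) λ M' → IsDerivableModel P M' × M' ⊆ M)
    × (∀ M → IsMinimalModel P M → IsDerivableModel P M)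
corollary4 {At} P horn =
    (largest , result-derivable horn uncapped)
  , (largest , result-derivable horn uncapped ,
     λ _ N-derivable → derivable-⊆-capped horn U⊨P N-derivable (λ _ _ → tt))
  , (λ _ → derivable⇒supported horn)
  , (λ M M⊨P → result (capped horn M M⊨P) ,
               result-derivable horn (capped horn M M⊨P) , capped-⊆ horn M⊨P)
  , (λ _ → minimal⇒derivable horn)
  where
    U⊨P : IsModel P U
    U⊨P = U-isModel P

    uncapped : Computation P
    uncapped = capped horn U U⊨P

    largest : Subset At
    largest = result uncapped
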